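{- As formal power series in $x$ whose coefficients are polynomials in $q$, \[ \sum_{m=0}^{\infty} q^m x^m (x;q)_m \;=\; \sum_{n=0}^{\infty} (-x)^{3n}\, q^{n(3n+1)/2}\left\{1 + x q^{2n+1} + x^2 q^{2n+1}\left(q^{n+1}-1\right)\right\}. \]
   Context: For $m\in\mathbb{N}$, $(x;q)_m=(1-x)(1-qx)\cdots(1-q^{m-1}x)$, and $(x;q)_0=1$. -}

module Defs where

open import Level using (_⊔_)
open import Algebra.Bundles using (CommutativeRing)
open import Data.Nat as ℕ using (ℕ; zero; suc; _∸_)
open import Data.Nat.DivMod using (_/_)

module PowerSeries {c ℓ} (R : CommutativeRing c ℓ) where
  open CommutativeRing R

  sumTo : ℕ → (ℕ → Carrier) → Carrier
  sumTo zero    f = 0#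
  sumTo (suc n) f = sumTo n f + f n

  pow : Carrier → ℕ → Carrier
  pow a zero    = 1#
  pow a (suc k) = a * pow a k

  Series : Set c
  Series = ℕ → Carrier

  one : Series
  one zero    = 1#
  one (suc _) = 0#

  X : Series
  X (suc zero) = 1#
  X _          = 0#

  _⊕_ : Series → Series → Series
  (f ⊕ g) n = f n + g n

  ⊖_ : Series → Series
  (⊖ f) n = - (f n)

  scale : Carrier → Series → Series
  scale a f n = a * f n

  _⊛_ : Series → Series → Series
  (f ⊛ g) n = sumTo (suc n) (λ k → f k * g (n ∸ k))

  powS : Series → ℕ → Series
  powS f zero    = one
  powS f (suc k) = f ⊛ powS f k

  poch : Carrier → ℕ → Series
  poch q zero    = one
  poch q (suc m) = poch q m ⊛ (one ⊕ (⊖ scale (pow q m) X))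

  lhsTerm : Carrier → ℕ → Series
  lhsTerm q m = scale (pow q m) (powS X m ⊛ poch q m)

  rhsTerm : Carrier → ℕ → Series
  rhsTerm q n =
    scale (pow q ((n ℕ.* (3 ℕ.* n ℕ.+ 1)) / 2))
      (powS (⊖ X) (3 ℕ.* n) ⊛
        ((one ⊕ scale (pow q (2 ℕ.* n ℕ.+ 1)) X) ⊕
          scale (pow q (2 ℕ.* n ℕ.+ 1) * (pow q (n ℕ.+ 1) - 1#)) (powS X 2)))

  -- The m-th summand on the left
  -- is divisible by x^m and the n-th on the right by x^{3n}, so only the
  -- summands with index ≤ N contribute to the coefficient of x^N.
  lhsCoeff : Carrier → ℕ → Carrier
  lhsCoeff q N = sumTo (suc N) (λ m → lhsTerm q m N)

  rhsCoeff : Carrier → ℕ → Carrier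
  rhsCoeff q N = sumTo (suc N) (λ n → rhsTerm q n N)

{-# OPTIONS --safe #-}
-- Write U(x) = Σ x^m (x;q)_m and G(x) = Σ q^m x^m (x;q)_m, the left-hand side, with coefficients
-- u N and g N.  The two factorisations (x;q)_{m+1} = (x;q)_m (1 - q^m x) = (1 - x) (qx;q)_m give
-- x² G(x) = (x - 1) U(x) + 1 and G(x) = 1 + q x (1 - x) U(qx).  Eliminating G leaves
-- U(x) = 1 + x - q x³ U(qx), that is u (N + 3) = - q^{N+1} u N with u 0 = u 1 = 1 and u 2 = 0.
-- Hence u is (-1)^n q^{n(3n-1)/2}, (-1)^n q^{n(3n+1)/2}, 0 at N = 3n, 3n + 1, 3n + 2, and so
-- g N = u (N + 1) - u (N + 2) is explicit.  On the right-hand side only the summand n = ⌊N/3⌋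
-- contributes to the coefficient of x^N, and it agrees with g N.
module Submission where

open import Algebra.Bundles using (CommutativeRing)
open import Data.Empty using (⊥-elim)
open import Data.Integer as ℤ using (ℤ; +_; -[1+_]; _⊖_)
import Data.Integer.Properties as ℤ
open import Data.Maybe as Maybe using (Maybe)
open import Data.Nat as ℕ using (ℕ; zero; suc; _∸_; _<_; _≤_; z≤n; s≤s)
import Data.Nat.Properties as ℕ
open import Data.Nat.DivMod using (_/_; _%_; m*n/n≡m; m≡m%n+[m/n]*n; m%n<n)
open import Data.Nat.Tactic.RingSolver using (solve-∀)
import Data.Sign as Sign
open import Function using (_∘_)
open import Relation.Binary.Consequences using (dec⇒weaklyDec)
open import Relation.Binary.Definitions using (tri<; tri≈; tri>)
open import Relation.Binary.PropositionalEquality as ≡ using (_≡_; _≢_)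
import Relation.Binary.Reasoning.Setoid as SetoidReasoning
open import Relation.Nullary using (yes; no)

open import Defs

-- Integer coefficients let the solver cancel x - x.  ι is built from the TC-optimised multiple so
-- that the constant :1 evaluates to 1# on the nose, which the solver's refl check needs.
module IntegerCoefficientSolver {c ℓ} (R : CommutativeRing c ℓ) where
  open CommutativeRing R
  open import Algebra.Properties.Ring ring
    using (-0#≈0#; -‿involutive; -‿+-comm; -‿distribˡ-*; -‿distribʳ-*; xyx⁻¹≈y)
  open import Algebra.Properties.Semiring.Mult.TCOptimised semiring
    using (_×_; ×-homo-+; ×1-homo-*)
  open import Algebra.Solver.Ring.AlmostCommutativeRing
    using (fromCommutativeRing; _-Raw-AlmostCommutative⟶_)
  open SetoidReasoning setoid

  ι : ℤ → Carrier
  ι (+ n)    = n × 1#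
  ι -[1+ n ] = - (suc n × 1#)

  ι-⊖ : ∀ m n → ι (m ⊖ n) ≈ m × 1# - n × 1#
  ι-⊖ m       zero    = sym (trans (+-congˡ -0#≈0#) (+-identityʳ _))
  ι-⊖ zero    (suc n) = sym (+-identityˡ _)
  ι-⊖ (suc m) (suc n) = begin
    ι (suc m ⊖ suc n)             ≡⟨ ≡.cong ι (ℤ.[1+m]⊖[1+n]≡m⊖n m n) ⟩
    ι (m ⊖ n)                     ≈⟨ ι-⊖ m n ⟩
    a - b                         ≈⟨ xyx⁻¹≈y 1# (a - b) ⟨
    1# + (a - b) - 1#             ≈⟨ +-congʳ (+-assoc 1# a (- b)) ⟨
    (1# + a) - b - 1#             ≈⟨ +-assoc (1# + a) (- b) (- 1#) ⟩
    (1# + a) + (- b - 1#)         ≈⟨ +-congˡ (+-comm (- b) (- 1#)) ⟩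
    (1# + a) + (- 1# - b)         ≈⟨ +-congˡ (-‿+-comm 1# b) ⟩
    (1# + a) - (1# + b)           ≈⟨ +-cong (×-homo-+ 1# 1 m) (-‿cong (×-homo-+ 1# 1 n)) ⟨
    suc m × 1# - suc n × 1#       ∎
    where a = m × 1#; b = n × 1#

  ι-+ : ∀ i j → ι (i ℤ.+ j) ≈ ι i + ι j
  ι-+ (+ m)    (+ n)    = ×-homo-+ 1# m n
  ι-+ (+ m)    -[1+ n ] = ι-⊖ m (suc n)
  ι-+ -[1+ m ] (+ n)    = trans (ι-⊖ n (suc m)) (+-comm _ _)
  ι-+ -[1+ m ] -[1+ n ] = begin
    - (suc (suc (m ℕ.+ n)) × 1#)       ≡⟨ ≡.cong (λ k → - (suc k × 1#)) (ℕ.+-suc m n) ⟨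
    - ((suc m ℕ.+ suc n) × 1#)         ≈⟨ -‿cong (×-homo-+ 1# (suc m) (suc n)) ⟩
    - (suc m × 1# + suc n × 1#)        ≈⟨ -‿+-comm _ _ ⟨
    - (suc m × 1#) + - (suc n × 1#)    ∎

  ι-+◃ : ∀ n → ι (Sign.+ ℤ.◃ n) ≈ n × 1#
  ι-+◃ zero    = refl
  ι-+◃ (suc n) = refl

  ι--◃ : ∀ n → ι (Sign.- ℤ.◃ n) ≈ - (n × 1#)
  ι--◃ zero    = sym -0#≈0#
  ι--◃ (suc n) = refl

  ι-* : ∀ i j → ι (i ℤ.* j) ≈ ι i * ι j
  ι-* (+ m)    (+ n)    = trans (ι-+◃ (m ℕ.* n)) (×1-homo-* m n)
  ι-* (+ m)    -[1+ n ] =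
    trans (ι--◃ (m ℕ.* suc n)) (trans (-‿cong (×1-homo-* m (suc n))) (-‿distribʳ-* _ _))
  ι-* -[1+ m ] (+ n)    =
    trans (ι--◃ (suc m ℕ.* n)) (trans (-‿cong (×1-homo-* (suc m) n)) (-‿distribˡ-* _ _))
  ι-* -[1+ m ] -[1+ n ] = begin
    ι (Sign.+ ℤ.◃ suc m ℕ.* suc n)     ≈⟨ ι-+◃ (suc m ℕ.* suc n) ⟩
    (suc m ℕ.* suc n) × 1#             ≈⟨ ×1-homo-* (suc m) (suc n) ⟩
    a * b                              ≈⟨ -‿involutive (a * b) ⟨
    - - (a * b)                        ≈⟨ -‿cong (-‿distribˡ-* a b) ⟩
    - (- a * b)                        ≈⟨ -‿distribʳ-* (- a) b ⟩
    - a * - b                          ∎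
    where a = suc m × 1#; b = suc n × 1#

  ι-neg : ∀ i → ι (ℤ.- i) ≈ - ι i
  ι-neg (+ zero)  = sym -0#≈0#
  ι-neg (+ suc n) = refl
  ι-neg -[1+ n ]  = sym (-‿involutive _)

  ι-homomorphism : ℤ.+-*-rawRing -Raw-AlmostCommutative⟶ fromCommutativeRing R
  ι-homomorphism = record
    { ⟦_⟧ = ι ; +-homo = ι-+ ; *-homo = ι-* ; -‿homo = ι-neg ; 0-homo = refl ; 1-homo = refl }

  ι-equal? : ∀ i j → Maybe (ι i ≈ ι j)
  ι-equal? i j = Maybe.map (λ { ≡.refl → refl }) (dec⇒weaklyDec ℤ._≟_ i j)

  open import Algebra.Solver.Ring ℤ.+-*-rawRing (fromCommutativeRing R) ι-homomorphism ι-equal?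
    public

  :0 :1 : ∀ {n} → Polynomial n
  :0 = con (+ 0)
  :1 = con (+ 1)

module PowerSeriesProperties {c ℓ} (R : CommutativeRing c ℓ) where
  open CommutativeRing R hiding (zero)
  open PowerSeries R
  open IntegerCoefficientSolver R using (solve; _:=_; _:+_; _:*_; _:-_; :-_; :0; :1)
  open import Algebra.Properties.Ring ring using (-0#≈0#)
  open SetoidReasoning setoid

  sumTo-cong : ∀ n {f g : ℕ → Carrier} → (∀ {k} → k < n → f k ≈ g k) → sumTo n f ≈ sumTo n g
  sumTo-cong zero    f≈g = refl
  sumTo-cong (suc n) f≈g = +-cong (sumTo-cong n (f≈g ∘ ℕ.m<n⇒m<1+n)) (f≈g (ℕ.n<1+n n))

  sumTo-zero : ∀ n {f : ℕ → Carrier} → (∀ {k} → k < n → f k ≈ 0#) → sumTo n f ≈ 0#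
  sumTo-zero zero    f≈0 = refl
  sumTo-zero (suc n) f≈0 =
    trans (+-cong (sumTo-zero n (f≈0 ∘ ℕ.m<n⇒m<1+n)) (f≈0 (ℕ.n<1+n n))) (+-identityˡ 0#)

  sumTo-single : ∀ n {f : ℕ → Carrier} {m} → m < n → (∀ {k} → k < n → k ≢ m → f k ≈ 0#) →
                 sumTo n f ≈ f m
  sumTo-single (suc n) {m = m} m<1+n f≈0 with m ℕ.≟ n
  ... | yes ≡.refl = trans (+-congʳ (sumTo-zero n (λ k<n → f≈0 (ℕ.m<n⇒m<1+n k<n) (ℕ.<⇒≢ k<n))))
                           (+-identityˡ _)
  ... | no m≢n = trans (+-cong (sumTo-single n (ℕ.≤∧≢⇒< (ℕ.≤-pred m<1+n) m≢n) (f≈0 ∘ ℕ.m<n⇒m<1+n))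
                               (f≈0 (ℕ.n<1+n n) (m≢n ∘ ≡.sym)))
                       (+-identityʳ _)

  sumTo-unfoldˡ : ∀ n f → sumTo (suc n) f ≈ f 0 + sumTo n (f ∘ suc)
  sumTo-unfoldˡ zero    f = trans (+-identityˡ _) (sym (+-identityʳ _))
  sumTo-unfoldˡ (suc n) f = trans (+-congʳ (sumTo-unfoldˡ n f)) (+-assoc _ _ _)

  sumTo-- : ∀ n f g → sumTo n (λ k → f k - g k) ≈ sumTo n f - sumTo n g
  sumTo-- zero    f g = sym (-‿inverseʳ 0#)
  sumTo-- (suc n) f g = begin
    sumTo n (λ k → f k - g k) + (f n - g n)   ≈⟨ +-congʳ (sumTo-- n f g) ⟩
    (sumTo n f - sumTo n g) + (f n - g n)
      ≈⟨ solve 4 (λ F G x y → (F :- G) :+ (x :- y) := (F :+ x) :- (G :+ y)) refl _ _ _ _ ⟩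
    (sumTo n f + f n) - (sumTo n g + g n)     ∎

  sumTo-*ˡ : ∀ n a f → sumTo n (λ k → a * f k) ≈ a * sumTo n f
  sumTo-*ˡ zero    a f = sym (zeroʳ a)
  sumTo-*ˡ (suc n) a f = trans (+-congʳ (sumTo-*ˡ n a f)) (sym (distribˡ a _ _))

  antidiagonal : ℕ → (ℕ → ℕ → Carrier) → Carrier
  antidiagonal N f = sumTo (suc N) (λ m → f m (N ∸ m))

  antidiagonal-cong : ∀ N {f g} → (∀ m j → m ℕ.+ j ≡ N → f m j ≈ g m j) →
                      antidiagonal N f ≈ antidiagonal N g
  antidiagonal-cong N f≈g =
    sumTo-cong (suc N) (λ {m} m<1+N → f≈g m (N ∸ m) (ℕ.m+[n∸m]≡n (ℕ.≤-pred m<1+N)))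

  antidiagonal-sucˡ : ∀ N f → antidiagonal (suc N) f ≈ f 0 (suc N) + antidiagonal N (f ∘ suc)
  antidiagonal-sucˡ N f = sumTo-unfoldˡ (suc N) _

  antidiagonal-sucʳ : ∀ N f →
                      antidiagonal (suc N) f ≈ antidiagonal N (λ m j → f m (suc j)) + f (suc N) 0
  antidiagonal-sucʳ N f = +-cong
    (sumTo-cong (suc N) (λ m<1+N → reflexive (≡.cong (f _) (ℕ.+-∸-assoc 1 (ℕ.≤-pred m<1+N)))))
    (reflexive (≡.cong (f (suc N)) (ℕ.n∸n≡0 N)))

  antidiagonal-- : ∀ N f g →
    antidiagonal N (λ m j → f m j - g m j) ≈ antidiagonal N f - antidiagonal N g
  antidiagonal-- N f g = sumTo-- (suc N) (λ m → f m (N ∸ m)) (λ m → g m (N ∸ m))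

  antidiagonal-*ˡ : ∀ N a f → antidiagonal N (λ m j → a * f m j) ≈ a * antidiagonal N f
  antidiagonal-*ˡ N a f = sumTo-*ˡ (suc N) a (λ m → f m (N ∸ m))

  pow-+ : ∀ x a b → pow x (a ℕ.+ b) ≈ pow x a * pow x b
  pow-+ x zero    b = sym (*-identityˡ _)
  pow-+ x (suc a) b = trans (*-congˡ (pow-+ x a b)) (sym (*-assoc _ _ _))

  pow-merge : ∀ x a b {d} → a ℕ.+ b ≡ d → pow x a * pow x b ≈ pow x d
  pow-merge x a b ≡.refl = sym (pow-+ x a b)

  pow-1# : ∀ n → pow 1# n ≈ 1#
  pow-1# zero    = refl
  pow-1# (suc n) = trans (*-identityˡ _) (pow-1# n)

  record IsMonomial (p : Series) (a : Carrier) (d : ℕ) : Set ℓ where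
    field
      leading  : p d ≈ a
      vanishes : ∀ {k} → k ≢ d → p k ≈ 0#

  open IsMonomial

  ⊛-monomial : ∀ {p a d} → IsMonomial p a d → ∀ h {n} → d ≤ n → (p ⊛ h) n ≈ a * h (n ∸ d)
  ⊛-monomial p-mono h d≤n = trans
    (sumTo-single _ (s≤s d≤n) (λ _ k≢d → trans (*-congʳ (vanishes p-mono k≢d)) (zeroˡ _)))
    (*-congʳ (leading p-mono))

  ⊛-monomial-< : ∀ {p a d} → IsMonomial p a d → ∀ h {n} → n < d → (p ⊛ h) n ≈ 0#
  ⊛-monomial-< p-mono h n<d = sumTo-zero _ (λ k<1+n →
    trans (*-congʳ (vanishes p-mono (ℕ.<⇒≢ (ℕ.≤-<-trans (ℕ.≤-pred k<1+n) n<d)))) (zeroˡ _))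

  powS-monomial : ∀ {p a} → IsMonomial p a 1 → ∀ m → IsMonomial (powS p m) (pow a m) m
  powS-monomial p-mono zero = record
    { leading  = refl
    ; vanishes = λ { {zero} 0≢0 → ⊥-elim (0≢0 ≡.refl) ; {suc _} _ → refl } }
  powS-monomial {p} p-mono (suc m) = record
    { leading  = trans (⊛-monomial p-mono (powS p m) (s≤s z≤n)) (*-congˡ (leading pᵐ))
    ; vanishes = λ
      { {zero}  _ → ⊛-monomial-< p-mono (powS p m) (s≤s z≤n)
      ; {suc k} k+1≢m+1 → trans (⊛-monomial p-mono (powS p m) (s≤s z≤n))
          (trans (*-congˡ (vanishes pᵐ (k+1≢m+1 ∘ ≡.cong suc))) (zeroʳ _)) } }
    where pᵐ = powS-monomial p-mono m

  X-monomial : IsMonomial X 1# 1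
  X-monomial = record
    { leading  = refl
    ; vanishes = λ { {zero} _ → refl ; {suc zero} 1≢1 → ⊥-elim (1≢1 ≡.refl) ; {suc (suc _)} _ → refl } }

  -X-monomial : IsMonomial (⊖ X) (- 1#) 1
  -X-monomial = record
    { leading  = refl
    ; vanishes = λ k≢1 → trans (-‿cong (vanishes X-monomial k≢1)) -0#≈0# }

  Xᵐ-monomial : ∀ m → IsMonomial (powS X m) 1# m
  Xᵐ-monomial m = record
    { leading  = trans (leading (powS-monomial X-monomial m)) (pow-1# m)
    ; vanishes = vanishes (powS-monomial X-monomial m) }

  ⊛[1-ax]-zero : ∀ h a → (h ⊛ (one ⊕ (⊖ scale a X))) 0 ≈ h 0
  ⊛[1-ax]-zero h a =
    solve 2 (λ h₀ a → :0 :+ h₀ :* (:1 :+ :- (a :* :0)) := h₀) refl (h 0) a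

  ⊛[1-ax]-suc : ∀ h a n → (h ⊛ (one ⊕ (⊖ scale a X))) (suc n) ≈ h (suc n) - a * h n
  ⊛[1-ax]-suc h a n = begin
    (sumTo n F + F n) + F (suc n)
      ≈⟨ +-cong (+-cong (sumTo-zero n F≈0) (*-congˡ (reflexive (≡.cong L (ℕ.m+n∸n≡m 1 n)))))
                (*-congˡ (reflexive (≡.cong L (ℕ.n∸n≡0 n)))) ⟩
    (0# + h n * L 1) + h (suc n) * L 0
      ≈⟨ solve 3 (λ x y a → (:0 :+ y :* (:0 :+ :- (a :* :1)))
                              :+ x :* (:1 :+ :- (a :* :0))
                            := x :- a :* y) refl (h (suc n)) (h n) a ⟩
    h (suc n) - a * h n ∎
    where
    L = one ⊕ (⊖ scale a X)
    F = λ k → h k * L (suc n ∸ k)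
    1+n∸k≡2+ : ∀ {k n} → k < n → suc n ∸ k ≡ suc (suc (n ∸ suc k))
    1+n∸k≡2+ {zero}  {suc n} _         = ≡.refl
    1+n∸k≡2+ {suc k} {suc n} (s≤s k<n) = 1+n∸k≡2+ k<n
    F≈0 : ∀ {k} → k < n → F k ≈ 0#
    F≈0 {k} k<n = begin
      h k * L (suc n ∸ k)         ≡⟨ ≡.cong (λ i → h k * L i) (1+n∸k≡2+ k<n) ⟩
      h k * (0# + - (a * 0#))     ≈⟨ solve 2 (λ x a → x :* (:0 :+ :- (a :* :0)) := :0)
                                            refl (h k) a ⟩
      0#                          ∎

-- pentagonal n = n(3n - 1)/2 and pentagonal′ n = n(3n + 1)/2.
pentagonal : ℕ → ℕ
pentagonal zero    = 0
pentagonal (suc n) = pentagonal n ℕ.+ suc (3 ℕ.* n)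

pentagonal′ : ℕ → ℕ
pentagonal′ n = pentagonal n ℕ.+ n

pentagonal-suc : ∀ n → pentagonal′ n ℕ.+ (2 ℕ.* n ℕ.+ 1) ≡ pentagonal (suc n)
pentagonal-suc n = regroup (pentagonal n) n
  where
  regroup : ∀ p n → p ℕ.+ n ℕ.+ (2 ℕ.* n ℕ.+ 1) ≡ p ℕ.+ suc (3 ℕ.* n)
  regroup = solve-∀

pentagonal′-suc : ∀ n → pentagonal′ n ℕ.+ suc (suc (3 ℕ.* n)) ≡ pentagonal′ (suc n)
pentagonal′-suc n = regroup (pentagonal n) n
  where
  regroup : ∀ p n → p ℕ.+ n ℕ.+ suc (suc (3 ℕ.* n)) ≡ p ℕ.+ suc (3 ℕ.* n) ℕ.+ suc n
  regroup = solve-∀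

pentagonal′-double : ∀ n → n ℕ.* (3 ℕ.* n ℕ.+ 1) ≡ pentagonal′ n ℕ.* 2
pentagonal′-double zero    = ≡.refl
pentagonal′-double (suc n) =
  ≡.trans (expand n) (≡.trans (≡.cong (ℕ._+ (6 ℕ.* n ℕ.+ 4)) (pentagonal′-double n))
                              (regroup (pentagonal n) n))
  where
  expand : ∀ n → suc n ℕ.* (3 ℕ.* suc n ℕ.+ 1) ≡ n ℕ.* (3 ℕ.* n ℕ.+ 1) ℕ.+ (6 ℕ.* n ℕ.+ 4)
  expand = solve-∀
  regroup : ∀ p n → (p ℕ.+ n) ℕ.* 2 ℕ.+ (6 ℕ.* n ℕ.+ 4) ≡ (p ℕ.+ suc (3 ℕ.* n) ℕ.+ suc n) ℕ.* 2
  regroup = solve-∀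

n[3n+1]/2≡pentagonal′ : ∀ n → n ℕ.* (3 ℕ.* n ℕ.+ 1) / 2 ≡ pentagonal′ n
n[3n+1]/2≡pentagonal′ n = ≡.trans (≡.cong (_/ 2) (pentagonal′-double n)) (m*n/n≡m (pentagonal′ n) 2)

module PochhammerSeries {c ℓ} (R : CommutativeRing c ℓ) (q : CommutativeRing.Carrier R) where
  open CommutativeRing R hiding (zero)
  open PowerSeries R
  open PowerSeriesProperties R
  open IsMonomial
  open IntegerCoefficientSolver R using (solve; _:=_; _:+_; _:*_; _:-_; :-_; :0; :1)
  open SetoidReasoning setoid

  pochCoeff : ℕ → ℕ → Carrier
  pochCoeff _       zero    = 1#
  pochCoeff zero    (suc k) = 0#
  pochCoeff (suc m) (suc k) = pochCoeff m (suc k) - pow q m * pochCoeff m k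

  poch≈pochCoeff : ∀ m k → poch q m k ≈ pochCoeff m k
  poch≈pochCoeff zero    zero    = refl
  poch≈pochCoeff zero    (suc k) = refl
  poch≈pochCoeff (suc m) zero    =
    trans (⊛[1-ax]-zero (poch q m) (pow q m)) (poch≈pochCoeff m zero)
  poch≈pochCoeff (suc m) (suc k) = trans (⊛[1-ax]-suc (poch q m) (pow q m) k)
    (+-cong (poch≈pochCoeff m (suc k)) (-‿cong (*-congˡ (poch≈pochCoeff m k))))

  -- (x;q)_{m+1} = (1 - x) (qx;q)_m
  pochCoeff-suc′ : ∀ m k →
    pochCoeff (suc m) (suc k) ≈ pow q (suc k) * pochCoeff m (suc k) - pow q k * pochCoeff m k
  pochCoeff-suc′ zero zero =
    solve 1 (λ q → :0 :- :1 :* :1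
                   := (q :* :1) :* :0 :- :1 :* :1) refl q
  pochCoeff-suc′ zero (suc k) =
    solve 2 (λ a b → :0 :- :1 :* :0 := a :* :0 :- b :* :0)
          refl (pow q (suc (suc k))) (pow q (suc k))
  pochCoeff-suc′ (suc m) zero = trans (+-congʳ (pochCoeff-suc′ m zero))
    (solve 3 (λ q A M → ((q :* :1) :* A :- :1 :* :1) :- (q :* M) :* :1
                        := (q :* :1) :* (A :- M :* :1) :- :1 :* :1)
           refl q (pochCoeff m 1) (pow q m))
  pochCoeff-suc′ (suc m) (suc k) =
    trans (+-cong (pochCoeff-suc′ m (suc k)) (-‿cong (*-congˡ (pochCoeff-suc′ m k))))
      (solve 6 (λ q K M A B C →
                  (q :* (q :* K) :* A :- q :* K :* B) :- (q :* M) :* (q :* K :* B :- K :* C)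
                  := q :* (q :* K) :* (A :- M :* B) :- q :* K :* (B :- M :* C))
             refl q (pow q k) (pow q m) (pochCoeff m (2 ℕ.+ k)) (pochCoeff m (suc k)) (pochCoeff m k))

  u g : ℕ → Carrier
  u N = antidiagonal N pochCoeff
  g N = antidiagonal N (λ m j → pow q m * pochCoeff m j)

  lhsCoeff≈g : ∀ N → lhsCoeff q N ≈ g N
  lhsCoeff≈g N = sumTo-cong (suc N) λ {m} m<1+N → *-congˡ (begin
    (powS X m ⊛ poch q m) N    ≈⟨ ⊛-monomial (Xᵐ-monomial m) (poch q m) (ℕ.≤-pred m<1+N) ⟩
    1# * poch q m (N ∸ m)      ≈⟨ *-identityˡ _ ⟩
    poch q m (N ∸ m)           ≈⟨ poch≈pochCoeff m (N ∸ m) ⟩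
    pochCoeff m (N ∸ m)        ∎)

  u[2+N] : ∀ N → u (suc (suc N)) ≈ u (suc N) - g N
  u[2+N] N = begin
    u (suc (suc N))                             ≈⟨ antidiagonal-sucˡ (suc N) pochCoeff ⟩
    0# + antidiagonal (suc N) (pochCoeff ∘ suc) ≈⟨ +-identityˡ _ ⟩
    antidiagonal (suc N) (pochCoeff ∘ suc)      ≈⟨ antidiagonal-sucʳ N (pochCoeff ∘ suc) ⟩
    antidiagonal N (λ m j → pochCoeff m (suc j) - pow q m * pochCoeff m j) + 1#
                                                ≈⟨ +-congʳ (antidiagonal-- N (λ m → pochCoeff m ∘ suc) G) ⟩
    (S - g N) + 1#                              ≈⟨ solve 2 (λ S G → (S :- G) :+ :1
                                                                  := (S :+ :1) :- G) refl S (g N) ⟩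
    (S + 1#) - g N                              ≈⟨ +-congʳ (antidiagonal-sucʳ N pochCoeff) ⟨
    u (suc N) - g N                             ∎
    where
    S = antidiagonal N (λ m j → pochCoeff m (suc j))
    G = λ m j → pow q m * pochCoeff m j

  g≈Δu : ∀ N → g N ≈ u (suc N) - u (suc (suc N))
  g≈Δu N = trans (solve 2 (λ G U → G := U :- (U :- G)) refl (g N) (u (suc N)))
                 (+-congˡ (-‿cong (sym (u[2+N] N))))

  g[2+N] : ∀ N → g (suc (suc N)) ≈ pow q (suc (suc N)) * u (suc N) - pow q (suc N) * u N
  g[2+N] N = begin
    g (suc (suc N))
      ≈⟨ antidiagonal-sucˡ (suc N) G ⟩
    1# * 0# + antidiagonal (suc N) (G ∘ suc)
      ≈⟨ +-cong (zeroʳ 1#) (antidiagonal-sucʳ N (G ∘ suc)) ⟩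
    0# + (antidiagonal N (λ m j → G (suc m) (suc j)) + Q₂ * 1#)
      ≈⟨ +-identityˡ _ ⟩
    antidiagonal N (λ m j → G (suc m) (suc j)) + Q₂ * 1#
      ≈⟨ +-congʳ (antidiagonal-cong N summand) ⟩
    antidiagonal N (λ m j → Q₂ * pochCoeff m (suc j) - Q₁ * pochCoeff m j) + Q₂ * 1#
      ≈⟨ +-congʳ (antidiagonal-- N (λ m j → Q₂ * pochCoeff m (suc j)) (λ m j → Q₁ * pochCoeff m j)) ⟩
    (antidiagonal N (λ m j → Q₂ * pochCoeff m (suc j)) - antidiagonal N (λ m j → Q₁ * pochCoeff m j))
      + Q₂ * 1#
      ≈⟨ +-congʳ (+-cong (antidiagonal-*ˡ N Q₂ (λ m → pochCoeff m ∘ suc))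
                         (-‿cong (antidiagonal-*ˡ N Q₁ pochCoeff))) ⟩
    (Q₂ * S - Q₁ * u N) + Q₂ * 1#
      ≈⟨ solve 4 (λ a b S U → (a :* S :- b :* U) :+ a :* :1
                              := a :* (S :+ :1) :- b :* U) refl Q₂ Q₁ S (u N) ⟩
    Q₂ * (S + 1#) - Q₁ * u N
      ≈⟨ +-congʳ (*-congˡ (antidiagonal-sucʳ N pochCoeff)) ⟨
    Q₂ * u (suc N) - Q₁ * u N ∎
    where
    G  = λ m j → pow q m * pochCoeff m j
    Q₂ = pow q (suc (suc N))
    Q₁ = pow q (suc N)
    S  = antidiagonal N (λ m j → pochCoeff m (suc j))
    summand : ∀ m j → m ℕ.+ j ≡ N →
              G (suc m) (suc j) ≈ Q₂ * pochCoeff m (suc j) - Q₁ * pochCoeff m j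
    summand m j m+j≡N = begin
      pow q (suc m) * pochCoeff (suc m) (suc j)
        ≈⟨ *-congˡ (pochCoeff-suc′ m j) ⟩
      pow q (suc m) * (pow q (suc j) * pochCoeff m (suc j) - pow q j * pochCoeff m j)
        ≈⟨ solve 5 (λ a b d x y → a :* (b :* x :- d :* y) := (a :* b) :* x :- (a :* d) :* y) refl
                   (pow q (suc m)) (pow q (suc j)) (pow q j) (pochCoeff m (suc j)) (pochCoeff m j) ⟩
      (pow q (suc m) * pow q (suc j)) * pochCoeff m (suc j)
        - (pow q (suc m) * pow q j) * pochCoeff m j
        ≈⟨ +-cong (*-congʳ (pow-merge q (suc m) (suc j) (≡.cong suc (≡.trans (ℕ.+-suc m j) 1+m+j≡1+N))))
                  (-‿cong (*-congʳ (pow-merge q (suc m) j 1+m+j≡1+N))) ⟩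
      Q₂ * pochCoeff m (suc j) - Q₁ * pochCoeff m j ∎
      where 1+m+j≡1+N = ≡.cong suc m+j≡N

  u₀ : u 0 ≈ 1#
  u₀ = +-identityˡ 1#

  u₁ : u 1 ≈ 1#
  u₁ = trans (+-congʳ (+-identityˡ 0#)) (+-identityˡ 1#)

  u₂ : u 2 ≈ 0#
  u₂ = trans (u[2+N] 0) (trans (+-cong u₁ (-‿cong (trans (+-identityˡ _) (*-identityˡ 1#))))
                                  (-‿inverseʳ 1#))

  u[3+N] : ∀ N → u (3 ℕ.+ N) ≈ - (pow q (suc N) * u N)
  u[3+N] zero = begin
    u 3                            ≈⟨ u[2+N] 1 ⟩
    u 2 - g 1                      ≈⟨ +-congʳ u₂ ⟩
    0# - g 1                       ≈⟨ solve 1 (λ q → :0 :- ((:0 :+ :1 :* :0)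
                                                                     :+ (q :* :1) :* :1)
                                                     := :- ((q :* :1) :* :1)) refl q ⟩
    - (pow q 1 * 1#)               ≈⟨ -‿cong (*-congˡ u₀) ⟨
    - (pow q 1 * u 0)              ∎
  u[3+N] (suc N) = begin
    u (4 ℕ.+ N)                                     ≈⟨ u[2+N] (suc (suc N)) ⟩
    u (3 ℕ.+ N) - g (suc (suc N))                   ≈⟨ +-cong (u[3+N] N) (-‿cong (g[2+N] N)) ⟩
    - (Q₁ * u N) - (Q₂ * u (suc N) - Q₁ * u N)
      ≈⟨ solve 4 (λ a b x y → :- (a :* x) :- (b :* y :- a :* x) := :- (b :* y))
                 refl Q₁ Q₂ (u N) (u (suc N)) ⟩
    - (Q₂ * u (suc N))                              ∎
    where
    Q₁ = pow q (suc N)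
    Q₂ = pow q (suc (suc N))

  sgn : ℕ → Carrier
  sgn n = pow (- 1#) (3 ℕ.* n)

  sgn-suc : ∀ n → sgn (suc n) ≈ - sgn n
  sgn-suc n = begin
    pow (- 1#) (3 ℕ.* suc n)         ≡⟨ ≡.cong (pow (- 1#)) (ℕ.*-suc 3 n) ⟩
    - 1# * (- 1# * (- 1# * sgn n))   ≈⟨ solve 1 (λ s → :- :1 :* (:- :1 :* (:- :1 :* s))
                                                       := :- s) refl (sgn n) ⟩
    - sgn n                          ∎

  u[3+N]-closed : ∀ N n a {b} → u N ≈ sgn n * pow q a → a ℕ.+ suc N ≡ b →
                  u (3 ℕ.+ N) ≈ sgn (suc n) * pow q b
  u[3+N]-closed N n a {b} uN≈ a+1+N≡b = begin
    u (3 ℕ.+ N)                             ≈⟨ u[3+N] N ⟩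
    - (pow q (suc N) * u N)                 ≈⟨ -‿cong (*-congˡ uN≈) ⟩
    - (pow q (suc N) * (sgn n * pow q a))   ≈⟨ solve 3 (λ Q s P → :- (Q :* (s :* P)) := (:- s) :* (P :* Q))
                                                     refl (pow q (suc N)) (sgn n) (pow q a) ⟩
    - sgn n * (pow q a * pow q (suc N))     ≈⟨ *-cong (sym (sgn-suc n)) (pow-merge q a (suc N) a+1+N≡b) ⟩
    sgn (suc n) * pow q b                   ∎

  u[3n] : ∀ n → u (3 ℕ.* n) ≈ sgn n * pow q (pentagonal n)
  u[3n] zero    = trans u₀ (sym (*-identityˡ 1#))
  u[3n] (suc n) = trans (reflexive (≡.cong u (ℕ.*-suc 3 n)))
                        (u[3+N]-closed (3 ℕ.* n) n (pentagonal n) (u[3n] n) ≡.refl)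

  u[1+3n] : ∀ n → u (suc (3 ℕ.* n)) ≈ sgn n * pow q (pentagonal′ n)
  u[1+3n] zero    = trans u₁ (sym (*-identityˡ 1#))
  u[1+3n] (suc n) =
    trans (reflexive (≡.cong (u ∘ suc) (ℕ.*-suc 3 n)))
          (u[3+N]-closed (suc (3 ℕ.* n)) n (pentagonal′ n) (u[1+3n] n) (pentagonal′-suc n))

  u[2+3n] : ∀ n → u (2 ℕ.+ 3 ℕ.* n) ≈ 0#
  u[2+3n] zero    = u₂
  u[2+3n] (suc n) = begin
    u (2 ℕ.+ 3 ℕ.* suc n)                          ≡⟨ ≡.cong (λ k → u (2 ℕ.+ k)) (ℕ.*-suc 3 n) ⟩
    u (3 ℕ.+ (2 ℕ.+ 3 ℕ.* n))                      ≈⟨ u[3+N] (2 ℕ.+ 3 ℕ.* n) ⟩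
    - (pow q (3 ℕ.+ 3 ℕ.* n) * u (2 ℕ.+ 3 ℕ.* n))  ≈⟨ -‿cong (*-congˡ (u[2+3n] n)) ⟩
    - (pow q (3 ℕ.+ 3 ℕ.* n) * 0#)                 ≈⟨ solve 1 (λ a → :- (a :* :0) := :0) refl _ ⟩
    0#                                             ∎

  linearCoeff quadraticCoeff : ℕ → Carrier
  linearCoeff    n = pow q (2 ℕ.* n ℕ.+ 1)
  quadraticCoeff n = linearCoeff n * (pow q (n ℕ.+ 1) - 1#)

  rhsFactor : ℕ → Series
  rhsFactor n = (one ⊕ scale (linearCoeff n) X) ⊕ scale (quadraticCoeff n) (powS X 2)

  rhsFactor-0 : ∀ n → rhsFactor n 0 ≈ 1#
  rhsFactor-0 n = trans (+-congˡ (*-congˡ (vanishes (Xᵐ-monomial 2) {0} (λ ()))))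
    (solve 2 (λ b c → (:1 :+ b :* :0) :+ c :* :0 := :1) refl (linearCoeff n) (quadraticCoeff n))

  rhsFactor-1 : ∀ n → rhsFactor n 1 ≈ linearCoeff n
  rhsFactor-1 n = trans (+-congˡ (*-congˡ (vanishes (Xᵐ-monomial 2) {1} (λ ()))))
    (solve 2 (λ b c → (:0 :+ b :* :1) :+ c :* :0 := b) refl (linearCoeff n) (quadraticCoeff n))

  rhsFactor-2 : ∀ n → rhsFactor n 2 ≈ quadraticCoeff n
  rhsFactor-2 n = trans (+-congˡ (*-congˡ (leading (Xᵐ-monomial 2))))
    (solve 2 (λ b c → (:0 :+ b :* :0) :+ c :* :1 := c) refl (linearCoeff n) (quadraticCoeff n))

  rhsFactor-≥3 : ∀ n {i} → 3 ≤ i → rhsFactor n i ≈ 0#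
  rhsFactor-≥3 n {3+i} (s≤s (s≤s (s≤s _))) =
    trans (+-congˡ (*-congˡ (vanishes (Xᵐ-monomial 2) {3+i} (λ ()))))
      (solve 2 (λ b c → (:0 :+ b :* :0) :+ c :* :0 := :0) refl (linearCoeff n) (quadraticCoeff n))

  g[j+3n] : ∀ n j → j < 3 → g (j ℕ.+ 3 ℕ.* n) ≈ pow q (pentagonal′ n) * (sgn n * rhsFactor n j)
  g[j+3n] n 0 _ = begin
    g (3 ℕ.* n)                                  ≈⟨ g≈Δu (3 ℕ.* n) ⟩
    u (suc (3 ℕ.* n)) - u (2 ℕ.+ 3 ℕ.* n)        ≈⟨ +-cong (u[1+3n] n) (-‿cong (u[2+3n] n)) ⟩
    sgn n * P - 0#                               ≈⟨ solve 2 (λ s P → s :* P :- :0 := P :* (s :* :1))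
                                                          refl (sgn n) P ⟩
    P * (sgn n * 1#)                             ≈⟨ *-congˡ (*-congˡ (rhsFactor-0 n)) ⟨
    P * (sgn n * rhsFactor n 0)                  ∎
    where P = pow q (pentagonal′ n)
  g[j+3n] n 1 _ = begin
    g (1 ℕ.+ 3 ℕ.* n)                            ≈⟨ g≈Δu (1 ℕ.+ 3 ℕ.* n) ⟩
    u (2 ℕ.+ 3 ℕ.* n) - u (3 ℕ.+ 3 ℕ.* n)
      ≈⟨ +-cong (u[2+3n] n) (-‿cong (u[3+N]-closed (3 ℕ.* n) n (pentagonal n) (u[3n] n) ≡.refl)) ⟩
    0# - sgn (suc n) * pow q (pentagonal (suc n))
      ≈⟨ +-congˡ (-‿cong (*-cong (sgn-suc n) (sym PB≈))) ⟩
    0# - (- sgn n) * (P * B)                     ≈⟨ solve 3 (λ s P B → :0 :- (:- s) :* (P :* B)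
                                                                    := P :* (s :* B)) refl (sgn n) P B ⟩
    P * (sgn n * B)                              ≈⟨ *-congˡ (*-congˡ (rhsFactor-1 n)) ⟨
    P * (sgn n * rhsFactor n 1)                  ∎
    where
    P = pow q (pentagonal′ n)
    B = linearCoeff n
    PB≈ : P * B ≈ pow q (pentagonal (suc n))
    PB≈ = pow-merge q (pentagonal′ n) (2 ℕ.* n ℕ.+ 1) (pentagonal-suc n)
  g[j+3n] n 2 _ = begin
    g (2 ℕ.+ 3 ℕ.* n)                            ≈⟨ g≈Δu (2 ℕ.+ 3 ℕ.* n) ⟩
    u (3 ℕ.+ 3 ℕ.* n) - u (4 ℕ.+ 3 ℕ.* n)
      ≈⟨ +-cong (u[3+N]-closed (3 ℕ.* n) n (pentagonal n) (u[3n] n) ≡.refl)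
                (-‿cong (u[3+N]-closed (suc (3 ℕ.* n)) n (pentagonal′ n) (u[1+3n] n)
                                        (pentagonal′-suc n))) ⟩
    sgn (suc n) * pow q (pentagonal (suc n)) - sgn (suc n) * pow q (pentagonal′ (suc n))
      ≈⟨ +-cong (*-cong (sgn-suc n) (sym PB≈)) (-‿cong (*-cong (sgn-suc n) (sym PBQ≈))) ⟩
    (- sgn n) * (P * B) - (- sgn n) * ((P * B) * Q)
      ≈⟨ solve 4 (λ s P B Q → (:- s) :* (P :* B) :- (:- s) :* ((P :* B) :* Q)
                              := P :* (s :* (B :* (Q :- :1)))) refl (sgn n) P B Q ⟩
    P * (sgn n * quadraticCoeff n)               ≈⟨ *-congˡ (*-congˡ (rhsFactor-2 n)) ⟨
    P * (sgn n * rhsFactor n 2)                  ∎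
    where
    P = pow q (pentagonal′ n)
    B = linearCoeff n
    Q = pow q (n ℕ.+ 1)
    PB≈ : P * B ≈ pow q (pentagonal (suc n))
    PB≈ = pow-merge q (pentagonal′ n) (2 ℕ.* n ℕ.+ 1) (pentagonal-suc n)
    PBQ≈ : (P * B) * Q ≈ pow q (pentagonal′ (suc n))
    PBQ≈ = trans (*-congʳ PB≈) (pow-merge q (pentagonal (suc n)) (n ℕ.+ 1)
                                          (≡.cong (pentagonal (suc n) ℕ.+_) (ℕ.+-comm n 1)))
  g[j+3n] n (suc (suc (suc _))) (s≤s (s≤s (s≤s ())))

  rhsTerm-at : ∀ k {N} → 3 ℕ.* k ≤ N →
               rhsTerm q k N ≈ pow q (pentagonal′ k) * (sgn k * rhsFactor k (N ∸ 3 ℕ.* k))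
  rhsTerm-at k 3k≤N =
    *-cong (reflexive (≡.cong (pow q) (n[3n+1]/2≡pentagonal′ k)))
           (⊛-monomial (powS-monomial -X-monomial (3 ℕ.* k)) (rhsFactor k) 3k≤N)

  rhsTerm-above : ∀ k {N} → N < 3 ℕ.* k → rhsTerm q k N ≈ 0#
  rhsTerm-above k N<3k =
    trans (*-congˡ (⊛-monomial-< (powS-monomial -X-monomial (3 ℕ.* k)) (rhsFactor k) N<3k)) (zeroʳ _)

  rhsTerm-below : ∀ k {N} → 3 ℕ.* suc k ≤ N → rhsTerm q k N ≈ 0#
  rhsTerm-below k {N} 3[k+1]≤N = begin
    rhsTerm q k N
      ≈⟨ rhsTerm-at k (ℕ.≤-trans (ℕ.*-monoʳ-≤ 3 (ℕ.n≤1+n k)) 3[k+1]≤N) ⟩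
    P * (sgn k * rhsFactor k (N ∸ 3 ℕ.* k))         ≈⟨ *-congˡ (*-congˡ (rhsFactor-≥3 k 3≤N∸3k)) ⟩
    P * (sgn k * 0#)                                ≈⟨ trans (*-congˡ (zeroʳ _)) (zeroʳ _) ⟩
    0#                                              ∎
    where
    P = pow q (pentagonal′ k)
    3≤N∸3k : 3 ≤ N ∸ 3 ℕ.* k
    3≤N∸3k = ℕ.m+n≤o⇒m≤o∸n 3 (≡.subst (_≤ N) (ℕ.*-suc 3 k) 3[k+1]≤N)

  rhsCoeff[j+3n] : ∀ n j → j < 3 →
                    rhsCoeff q (j ℕ.+ 3 ℕ.* n) ≈ pow q (pentagonal′ n) * (sgn n * rhsFactor n j)
  rhsCoeff[j+3n] n j j<3 = begin
    rhsCoeff q N                                            ≈⟨ sumTo-single (suc N) (s≤s n≤N) others ⟩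
    rhsTerm q n N                                           ≈⟨ rhsTerm-at n (ℕ.m≤n+m (3 ℕ.* n) j) ⟩
    pow q (pentagonal′ n) * (sgn n * rhsFactor n (N ∸ 3 ℕ.* n))
      ≡⟨ ≡.cong (λ i → pow q (pentagonal′ n) * (sgn n * rhsFactor n i)) (ℕ.m+n∸n≡m j (3 ℕ.* n)) ⟩
    pow q (pentagonal′ n) * (sgn n * rhsFactor n j)         ∎
    where
    N = j ℕ.+ 3 ℕ.* n
    n≤N : n ≤ N
    n≤N = ℕ.≤-trans (ℕ.m≤n*m n 3) (ℕ.m≤n+m (3 ℕ.* n) j)
    others : ∀ {k} → k < suc N → k ≢ n → rhsTerm q k N ≈ 0#
    others {k} _ k≢n with ℕ.<-cmp k n
    ... | tri< k<n _ _ = rhsTerm-below k (ℕ.≤-trans (ℕ.*-monoʳ-≤ 3 k<n) (ℕ.m≤n+m (3 ℕ.* n) j))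
    ... | tri≈ _ k≡n _ = ⊥-elim (k≢n k≡n)
    ... | tri> _ _ n<k = rhsTerm-above k (ℕ.<-≤-trans (ℕ.+-monoˡ-< (3 ℕ.* n) j<3)
                           (ℕ.≤-trans (ℕ.≤-reflexive (≡.sym (ℕ.*-suc 3 n))) (ℕ.*-monoʳ-≤ 3 n<k)))

mainTheorem2 : ∀ {c ℓ} (R : CommutativeRing c ℓ) (q : CommutativeRing.Carrier R) (N : ℕ) →
                 CommutativeRing._≈_ R (PowerSeries.lhsCoeff R q N) (PowerSeries.rhsCoeff R q N)
mainTheorem2 R q N = ≡.subst (λ M → lhsCoeff q M ≈ rhsCoeff q M) (≡.sym N≡j+3n) (begin
  lhsCoeff q (j ℕ.+ 3 ℕ.* n)                        ≈⟨ lhsCoeff≈g (j ℕ.+ 3 ℕ.* n) ⟩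
  g (j ℕ.+ 3 ℕ.* n)                                 ≈⟨ g[j+3n] n j j<3 ⟩
  pow q (pentagonal′ n) * (sgn n * rhsFactor n j)   ≈⟨ rhsCoeff[j+3n] n j j<3 ⟨
  rhsCoeff q (j ℕ.+ 3 ℕ.* n)                        ∎)
  where
  open CommutativeRing R using (_≈_; _*_; setoid)
  open PowerSeries R using (lhsCoeff; rhsCoeff; pow)
  open PochhammerSeries R q using (lhsCoeff≈g; g; g[j+3n]; sgn; rhsFactor; rhsCoeff[j+3n])
  open SetoidReasoning setoid
  n = N / 3
  j = N % 3
  j<3 = m%n<n N 3
  N≡j+3n : N ≡ j ℕ.+ 3 ℕ.* n
  N≡j+3n = ≡.trans (m≡m%n+[m/n]*n N 3) (≡.cong (j ℕ.+_) (ℕ.*-comm n 3))
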